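{- Let $\Lambda$ be a restorative similarity type and $\mathfrak{M}=\langle W,R,\{P_k\}_{k\in K}\rangle$ a Kripke model. For all $w,v\in W$: if there is a symmetrical $\Lambda$-simulation $S$ on $\mathfrak{M}$ with $(w,v)\in S$, then $w$ and $v$ satisfy exactly the same formulas of $\mathcal{L}_{\sim,\Lambda}$.
   Context: Fix a set $K$. A Kripke model is $\mathfrak{M}=\langle W,R,\{P_k\}_{k\in K}\rangle$ with $W$ nonempty, $R\subseteq W\times W$, each $P_k\subseteq W$. Six unary connectives $\smile,\frown,\circ_\smile,\circ_\frown,\bullet_\smile,\bullet_\frown$; a restorative similarity type is any subset $\Lambda$ of these. $\mathcal{L}_{\sim,\Lambda}$ is generated by $\phi::=p_k\mid\top\mid\bot\mid\phi\wedge\phi\mid\phi\vee\phi\mid\sim\phi\mid\star\phi$ ($\star\in\Lambda$). Satisfaction: $w\Vdash p_k$ iff $w\in P_k$; $\top,\bot,\wedge,\vee$ classical; $w\Vdash\sim\phi$ iff $w\not\Vdash\phi$; $w\Vdash\smile\phi$ iff some $v$ with $wRv$ has $v\not\Vdash\phi$; $w\Vdash\frown\phi$ iff every $v$ with $wRv$ has $v\not\Vdash\phi$; $w\Vdash\circ_\smile\phi$ iff $w\not\Vdash\phi$ or every $v$ with $wRv$ has $v\Vdash\phi$; $w\Vdash\circ_\frown\phi$ iff $w\Vdash\phi$ or every $v$ with $wRv$ has $v\not\Vdash\phi$; $w\Vdash\bullet_\smile\phi$ iff $w\Vdash\phi$ and some $v$ with $wRv$ has $v\not\Vdash\phi$;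 $w\Vdash\bullet_\frown\phi$ iff $w\not\Vdash\phi$ and some $v$ with $wRv$ has $v\Vdash\phi$. A relation $S\subseteq W\times W$ is a $\Lambda$-simulation on $\mathfrak{M}$ if it satisfies (Sim$_k$) for every $k$ and (Sim$\star$) for every $\star\in\Lambda$ (worlds range over $W$): (Sim$_k$) if $(w,v)\in S$ and $w\in P_k$ then $v\in P_k$; (Sim$\smile$) if $(w,v)\in S$ and $wRs$ then there is $t$ with $vRt$ and $(t,s)\in S$; (Sim$\frown$) if $(w,v)\in S$ and $vRt$ then there is $s$ with $wRs$ and $(t,s)\in S$; (Sim$\circ_\smile$) if $(w,v)\in S$ and $vRt$ then either $(v,t)\in S$, or both $(v,w)\in S$ and there is $s$ with $wRs$ and $(s,t)\in S$; (Sim$\circ_\frown$) if $(w,v)\in S$ and $vRt$ then either $(t,v)\in S$, or there is $s$ with $wRs$ and $(t,s)\in S$; (Sim$\bullet_\smile$) if $(w,v)\in S$ and $wRs$ then either $(w,s)\in S$, or there is $t$ with $vRt$ and $(t,s)\in S$; (Sim$\bullet_\frown$) if $(w,v)\in S$ and $wRs$ then either $(s,w)\in S$, or both $(v,w)\in S$ and there is $t$ with $vRt$ and $(s,t)\in S$. A symmetrical $\Lambda$-simulation is a $\Lambda$-simulation $S$ such that $(w,v)\in S$ implies $(v,w)\in S$. -}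

module Defs where

open import Data.Product using (Σ; ∃; _×_; _,_)
open import Data.Sum using (_⊎_)
open import Data.Empty using (⊥)
open import Data.Unit using (⊤)
open import Relation.Nullary using (¬_)

data Conn : Set where
  ⌣ ⌢ ∘⌣ ∘⌢ •⌣ •⌢ : Conn

SimType : Set₁
SimType = Conn → Set

record Kripke (K : Set) : Set₁ where
  field
    W : Set
    inhabited : W
    R : W → W → Set
    P : K → W → Set

data Form (K : Set) (Λ : SimType) : Set where
  var  : K → Form K Λ
  ⊤'   : Form K Λ
  ⊥'   : Form K Λ
  _∧'_ : Form K Λ → Form K Λ → Form K Λ
  _∨'_ : Form K Λ → Form K Λ → Form K Λ
  ∼_   : Form K Λ → Form K Λ
  ⋆    : (c : Conn) → Λ c → Form K Λ → Form K Λ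

module _ {K : Set} (M : Kripke K) where
  open Kripke M

  infix 4 _⊩_
  _⊩_ : {Λ : SimType} → W → Form K Λ → Set
  w ⊩ var k      = P k w
  w ⊩ ⊤'         = ⊤
  w ⊩ ⊥'         = ⊥
  w ⊩ (φ ∧' ψ)   = (w ⊩ φ) × (w ⊩ ψ)
  w ⊩ (φ ∨' ψ)   = (w ⊩ φ) ⊎ (w ⊩ ψ)
  w ⊩ (∼ φ)      = ¬ (w ⊩ φ)
  w ⊩ ⋆ ⌣  _ φ   = ∃ λ v → R w v × ¬ (v ⊩ φ)
  w ⊩ ⋆ ⌢  _ φ   = ∀ v → R w v → ¬ (v ⊩ φ)
  w ⊩ ⋆ ∘⌣ _ φ   = ¬ (w ⊩ φ) ⊎ (∀ v → R w v → v ⊩ φ)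
  w ⊩ ⋆ ∘⌢ _ φ   = (w ⊩ φ) ⊎ (∀ v → R w v → ¬ (v ⊩ φ))
  w ⊩ ⋆ •⌣ _ φ   = (w ⊩ φ) × (∃ λ v → R w v × ¬ (v ⊩ φ))
  w ⊩ ⋆ •⌢ _ φ   = ¬ (w ⊩ φ) × (∃ λ v → R w v × (v ⊩ φ))

  SimClause : (W → W → Set) → Conn → Set
  SimClause S ⌣  = ∀ w v s → S w v → R w s → ∃ λ t → R v t × S t s
  SimClause S ⌢  = ∀ w v t → S w v → R v t → ∃ λ s → R w s × S t s
  SimClause S ∘⌣ = ∀ w v t → S w v → R v t →
                     S v t ⊎ (S v w × (∃ λ s → R w s × S s t))
  SimClause S ∘⌢ = ∀ w v t → S w v → R v t →
                     S t v ⊎ (∃ λ s → R w s × S t s)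
  SimClause S •⌣ = ∀ w v s → S w v → R w s →
                     S w s ⊎ (∃ λ t → R v t × S t s)
  SimClause S •⌢ = ∀ w v s → S w v → R w s →
                     S s w ⊎ (S v w × (∃ λ t → R v t × S s t))

  record IsSimulation (Λ : SimType) (S : W → W → Set) : Set₁ where
    field
      simₖ : ∀ k w v → S w v → P k w → P k v
      sim⋆ : ∀ c → Λ c → SimClause S c

  record IsSymSimulation (Λ : SimType) (S : W → W → Set) : Set₁ where
    field
      isSim : IsSimulation Λ S
      sym   : ∀ w v → S w v → S v w

{-# OPTIONS --safe #-}
module Submission where

open import Defs
open import Level using (0ℓ)
open import Data.Product using (∃; _×_; _,_)
import Data.Product as Product
import Data.Sum as Sum
open import Data.Sum using (_⊎_; inj₁; inj₂)
open import Data.Empty using (⊥; ⊥-elim)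
open import Data.Unit using (tt)
open import Function using (_∘_)
open import Function.Bundles using (_⇔_; mk⇔)
open import Axiom.ExcludedMiddle using (ExcludedMiddle)
open import Relation.Nullary using (yes; no)

-- Symmetry lets the induction hypothesis be used against the
-- direction of S, which covers negation and the "backward" pairs (v, w), (t, s)
-- appearing in the simulation clauses. The clause for each connective is
-- designed so that its witness transports the relevant (non-)satisfaction; only
-- for ∘⌣ and ∘⌢ must one first decide classically whether v satisfies φ.

module SymmetricSimulation {K : Set} {Λ : SimType} (M : Kripke K)
  {S : Kripke.W M → Kripke.W M → Set} (isSymSim : IsSymSimulation M Λ S) where
  open Kripke M
  open IsSymSimulation isSymSim
  open IsSimulation isSim

  infix 4 _⊨_
  _⊨_ : W → Form K Λ → Set
  a ⊨ φ = _⊩_ M a φ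

  Preserved : Form K Λ → Set
  Preserved φ = ∀ {a b} → S a b → a ⊨ φ → b ⊨ φ

  module _ {φ : Form K Λ} (pres : Preserved φ) where

    ∼-preserved : Preserved (∼ φ)
    ∼-preserved sab a⊭φ = a⊭φ ∘ pres (sym _ _ sab)

    ⌣-preserved : (p : Λ ⌣) → Preserved (⋆ ⌣ p φ)
    ⌣-preserved p {a} {b} sab (x , rax , x⊭φ) with sim⋆ ⌣ p a b x sab rax
    ... | t , rbt , stx = t , rbt , x⊭φ ∘ pres stx

    ⌢-preserved : (p : Λ ⌢) → Preserved (⋆ ⌢ p φ)
    ⌢-preserved p {a} {b} sab a⊨⌢φ t rbt t⊨φ with sim⋆ ⌢ p a b t sab rbt
    ... | x , rax , stx = a⊨⌢φ x rax (pres stx t⊨φ)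

    ∘⌣-preserved : ExcludedMiddle 0ℓ → (p : Λ ∘⌣) → Preserved (⋆ ∘⌣ p φ)
    ∘⌣-preserved em p sab (inj₁ a⊭φ) = inj₁ (a⊭φ ∘ pres (sym _ _ sab))
    ∘⌣-preserved em p {a} {b} sab (inj₂ a↝φ) with em {b ⊨ φ}
    ... | no b⊭φ = inj₁ b⊭φ
    ... | yes b⊨φ = inj₂ λ t rbt → case (sim⋆ ∘⌣ p a b t sab rbt)
      where
      case : ∀ {t} → S b t ⊎ (S b a × ∃ λ x → R a x × S x t) → t ⊨ φ
      case (inj₁ sbt) = pres sbt b⊨φ
      case (inj₂ (_ , x , rax , sxt)) = pres sxt (a↝φ x rax)

    ∘⌢-preserved : ExcludedMiddle 0ℓ → (p : Λ ∘⌢) → Preserved (⋆ ∘⌢ p φ)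
    ∘⌢-preserved em p sab (inj₁ a⊨φ) = inj₁ (pres sab a⊨φ)
    ∘⌢-preserved em p {a} {b} sab (inj₂ a↝¬φ) with em {b ⊨ φ}
    ... | yes b⊨φ = inj₁ b⊨φ
    ... | no b⊭φ = inj₂ λ t rbt t⊨φ → case t⊨φ (sim⋆ ∘⌢ p a b t sab rbt)
      where
      case : ∀ {t} → t ⊨ φ → S t b ⊎ (∃ λ x → R a x × S t x) → ⊥
      case t⊨φ (inj₁ stb) = b⊭φ (pres stb t⊨φ)
      case t⊨φ (inj₂ (x , rax , stx)) = a↝¬φ x rax (pres stx t⊨φ)

    •⌣-preserved : (p : Λ •⌣) → Preserved (⋆ •⌣ p φ)
    •⌣-preserved p {a} {b} sab (a⊨φ , x , rax , x⊭φ) with sim⋆ •⌣ p a b x sab rax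
    ... | inj₁ sax = ⊥-elim (x⊭φ (pres sax a⊨φ))
    ... | inj₂ (t , rbt , stx) = pres sab a⊨φ , t , rbt , x⊭φ ∘ pres stx

    •⌢-preserved : (p : Λ •⌢) → Preserved (⋆ •⌢ p φ)
    •⌢-preserved p {a} {b} sab (a⊭φ , x , rax , x⊨φ) with sim⋆ •⌢ p a b x sab rax
    ... | inj₁ sxa = ⊥-elim (a⊭φ (pres sxa x⊨φ))
    ... | inj₂ (sba , t , rbt , sxt) = a⊭φ ∘ pres sba , t , rbt , pres sxt x⊨φ

    ⋆-preserved : ExcludedMiddle 0ℓ → (c : Conn) (p : Λ c) → Preserved (⋆ c p φ)
    ⋆-preserved em ⌣  = ⌣-preserved
    ⋆-preserved em ⌢  = ⌢-preserved
    ⋆-preserved em ∘⌣ = ∘⌣-preserved em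
    ⋆-preserved em ∘⌢ = ∘⌢-preserved em
    ⋆-preserved em •⌣ = •⌣-preserved
    ⋆-preserved em •⌢ = •⌢-preserved

  preserved : ExcludedMiddle 0ℓ → (φ : Form K Λ) → Preserved φ
  preserved em (var k)   = simₖ k _ _
  preserved em ⊤'        = λ _ _ → tt
  preserved em ⊥'        = λ _ ()
  preserved em (φ ∧' ψ)  = λ sab → Product.map (preserved em φ sab) (preserved em ψ sab)
  preserved em (φ ∨' ψ)  = λ sab → Sum.map (preserved em φ sab) (preserved em ψ sab)
  preserved em (∼ φ)     = ∼-preserved {φ} (preserved em φ)
  preserved em (⋆ c p φ) = ⋆-preserved {φ} (preserved em φ) em c p

theorem8p4 : ExcludedMiddle 0ℓ →
    (K : Set) (Λ : SimType) (M : Kripke K) →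
    (w v : Kripke.W M) →
    (∃ λ (S : Kripke.W M → Kripke.W M → Set) → IsSymSimulation M Λ S × S w v) →
    (φ : Form K Λ) → (_⊩_ M w φ ⇔ _⊩_ M v φ)
theorem8p4 em K Λ M w v (S , isSymSim , swv) φ =
  mk⇔ (preserved em φ swv) (preserved em φ (IsSymSimulation.sym isSymSim w v swv))
  where open SymmetricSimulation M isSymSim
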